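{- Let $n\ge1$, $k\ge2$. In any play $s_0,s_1,\dots$ of the infinite $(n,k)$-shift-game in which Alice applies $A_{tail}$ and Bob applies a strategy $B$, if $t_1<t_2$ are indices of the play with $B(s_{t_1})=B(s_{t_2})=1$, then $val(s_{t_1+1})<val(s_{t_2+1})$.
   Context: $[k]=\{0,\dots,k-1\}$; words written by concatenation. A strategy for Bob is $B\colon[k]^n\to\{0,1\}$ with $B(x(k-1))=0$ for all $x\in[k]^{n-1}$; a strategy for Alice is $A\colon[k]^n\to\{0,1\}$ with $A(x0)=0$ for all $x$. The infinite $(n,k)$-shift-game: a play is a (finite or infinite) sequence $s_0,s_1,\dots$ with $s_0=0^n$ and, if $s_t=x\sigma$, then $s_{t+1}=(\sigma+1)x$ if $B(s_t)=1$; $s_{t+1}=0x$ if $B(s_t)=0$ and $A(s_t)=1$; $s_{t+1}=\sigma x$ otherwise; the play stops only at the first $m>0$ with $s_m=0^n$ (Alice then wins); if this never happens the play is infinite and Bob wins. For $s=\sigma_0\cdots\sigma_{n-1}\in[k]^n$ and $0\le m<n$: $val(s,m)=\sum_{i=1}^n \sigma_{(m-i)\bmod n}k^{i-1}$; $val(s)=\max_{0\le m<n}val(s,m)$; $head(s)=\min\{m : val(s,m)=val(s)\}$; for $s\ne0^n$, $tail(s)=\big(\max\{i\in\mathbb{Z} : i<head(s),\ \sigma_{i\bmod n}\ne0\}\big)\bmod n$. $A_{tail}(s)=1$ if $s\ne0^n$ and $tail(s)=n-1$, and $A_{tail}(s)=0$ otherwise. -}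

module Defs where

open import Data.Nat using (ℕ; zero; suc; _+_; _*_; _∸_; _^_; _⊔_; _<?_; _≡ᵇ_; NonZero; >-nonZero⁻¹)
open import Data.Nat.DivMod using (_%_; m%n<n)
open import Data.Fin using (Fin; toℕ; fromℕ<; _≟_)
open import Data.Vec using (Vec; lookup; tabulate; replicate)
open import Data.Vec.Properties using (≡-dec)
open import Data.Bool using (Bool; true; false; if_then_else_; not; _∧_)
open import Relation.Nullary using (does; yes; no)
open import Relation.Binary.PropositionalEquality using (_≡_)
import Data.Empty

sumTo : (ℕ → ℕ) → ℕ → ℕ
sumTo f zero = 0
sumTo f (suc N) = sumTo f N + f N

maxTo : (ℕ → ℕ) → ℕ → ℕ
maxTo f zero = 0
maxTo f (suc N) = maxTo f N ⊔ f N

-- least i in [i₀, i₀+N) with p i = true; returns i₀+N if there is none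
search : (ℕ → Bool) → ℕ → ℕ → ℕ
search p i zero = i
search p i (suc N) = if p i then i else search p (suc i) N

module Game (n k : ℕ) .{{_ : NonZero n}} .{{_ : NonZero k}} where

  Word : Set
  Word = Vec (Fin k) n

  zeroL : Fin k
  zeroL = fromℕ< (>-nonZero⁻¹ k)

  zeroW : Word
  zeroW = replicate n zeroL

  at : Word → ℕ → Fin k
  at s i = lookup s (fromℕ< (m%n<n i n))

  dig : Word → ℕ → ℕ
  dig s i = toℕ (at s i)

  -- val(s,m) = Σ_{i=1}^{n} σ_{(m-i) mod n} k^{i-1}   (i = j+1; for m < n, (m+n-i) ≡ m-i mod n)
  valAt : Word → ℕ → ℕ
  valAt s m = sumTo (λ j → dig s (m + n ∸ suc j) * k ^ j) n

  val : Word → ℕ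
  val s = maxTo (valAt s) n

  head : Word → ℕ
  head s = search (λ m → valAt s m ≡ᵇ val s) 0 n

  isZero : Word → Bool
  isZero s = does (≡-dec _≟_ s zeroW)

  -- tail(s) = (max { i < head(s) : σ_{i mod n} ≠ 0 }) mod n, written with i = head(s) - d,
  -- d the least d ≥ 1 with σ_{(head(s)-d) mod n} ≠ 0 (d ≤ n when s ≠ 0^n)
  tail : Word → ℕ
  tail s = (head s + n ∸ d) % n
    where
    d : ℕ
    d = search (λ d → not (dig s (head s + n ∸ d) ≡ᵇ 0)) 1 n

  Atail : Word → Bool
  Atail s = not (isZero s) ∧ (tail s ≡ᵇ (n ∸ 1))

  IsBobStrategy : (Word → Bool) → Set
  IsBobStrategy B = ∀ s → dig s (n ∸ 1) ≡ k ∸ 1 → B s ≡ false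

  -- σ+1 (the fallback branch σ = k-1 never occurs when B is a Bob strategy)
  inc : Fin k → Fin k
  inc σ with suc (toℕ σ) <? k
  ... | yes p = fromℕ< p
  ... | no _ = σ

  -- c x  where s = x σ
  shift : Fin k → Word → Word
  shift c s = tabulate λ j → f (toℕ j)
    where
    f : ℕ → Fin k
    f zero = c
    f (suc i) = at s i

  step : (Word → Bool) → (Word → Bool) → Word → Word
  step A B s =
    if B s then shift (inc σ) s
    else if A s then shift zeroL s
    else shift σ s
    where
    σ : Fin k
    σ = at s (n ∸ 1)

  -- the sequence s₀ = 0^n, s_{t+1} = step(s_t) (the play is its initial part up to the
  -- first return to 0^n)
  play : (Word → Bool) → (Word → Bool) → ℕ → Word
  play A B zero = zeroW
  play A B (suc t) = step A B (play A B t)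

  -- s_{t+1} is still part of the play: no s_j with 0 < j ≤ t equals 0^n
  Continues : (Word → Bool) → (Word → Bool) → ℕ → Set
  Continues A B t = ∀ j → 1 Data.Nat.≤ j → j Data.Nat.≤ t → play A B j ≡ zeroW → Data.Empty.⊥

module Submission where

-- Say that s has a head after zeros at m when s = 0^m σ_m ⋯ σ_{n-1} and its rotation starting at m
-- has maximal value; then head(s) = m, and A_tail(s) = 1 exactly when s ≠ 0^n has a head after
-- zeros and σ_{n-1} ≠ 0.
-- With V = val(s_{t₁+1}), every later position s of the play satisfies: either val(s) ≥ V, or s has
-- a head after zeros at some m with V < val(s,m) + k^m. A pass merely rotates s, so val is kept.
-- Alice's move shifts in a 0: the head after zeros moves from m to m + 1 (dropping the last letter
-- cannot make another rotation overtake the one at m), and val(s,m) + k^m ≤ val(s',m+1) + k^{m+1}.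
-- When s has a head after zeros Alice always moves, unless σ_{n-1} = 0, in which case passing is the
-- same as her move. Bob's move raises val(s,h) to val(s,h) + k^h for every h, hence above V.

open import Defs
open import Data.Nat
open import Data.Nat.Properties
open import Data.Nat.DivMod using (_%_; m%n<n; [m+n]%n≡m%n; m<n⇒m%n≡m)
open import Data.Bool using (Bool; true; false; not; _∧_)
open import Data.Bool.Properties using (T-≡)
open import Data.Fin using (toℕ; fromℕ<)
import Data.Fin as Fin
open import Data.Fin.Properties using (fromℕ<-cong; toℕ-fromℕ<; toℕ<n; fromℕ<-toℕ; toℕ-injective)
open import Data.Vec using (lookup; tabulate)
open import Data.Vec.Properties using (≡-dec; lookup∘tabulate; lookup-replicate; tabulate∘lookup; tabulate-cong)
open import Data.Product using (_×_; _,_; ∃-syntax)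
open import Data.Sum using (inj₁; inj₂)
open import Function using (case_of_)
open import Function.Bundles using (module Equivalence)
open import Relation.Nullary using (¬_; yes; no; contradiction)
open import Relation.Nullary.Decidable using (dec-true; dec-false)
open import Relation.Binary.PropositionalEquality
  using (_≡_; _≢_; refl; sym; trans; cong; cong₂; subst; subst₂; module ≡-Reasoning)
open import Relation.Binary.Definitions using (tri<; tri≈; tri>)
open import Algebra.Properties.CommutativeSemigroup +-commutativeSemigroup
  using () renaming (xy∙z≈xz∙y to +-rightComm)
open import Algebra.Properties.CommutativeSemigroup *-commutativeSemigroup
  using () renaming (x∙yz≈y∙xz to *-leftComm)

≡ᵇ⇒≡-true : ∀ {m n} → (m ≡ᵇ n) ≡ true → m ≡ n
≡ᵇ⇒≡-true {m} {n} e = ≡ᵇ⇒≡ m n (Equivalence.from T-≡ e)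

nonzero≡false⇒≡0 : ∀ {d} → not (d ≡ᵇ 0) ≡ false → d ≡ 0
nonzero≡false⇒≡0 {zero} _ = refl

≢0⇒nonzero≡true : ∀ {d} → d ≢ 0 → not (d ≡ᵇ 0) ≡ true
≢0⇒nonzero≡true {zero}  d≢0 = contradiction refl d≢0
≢0⇒nonzero≡true {suc _} _   = refl

x<c*x : ∀ {c x} → 1 < c → 0 < c * x → x < c * x
x<c*x {c} {zero}  _   0<c*0 = contradiction 0<c*0 (<-irrefl (sym (*-zeroʳ c)))
x<c*x {c} {suc x} 1<c _     = subst (suc x <_) (*-comm (suc x) c) (m<m*n (suc x) c 1<c)

sumTo-cong : ∀ {f g} N → (∀ i → i < N → f i ≡ g i) → sumTo f N ≡ sumTo g N
sumTo-cong zero    _   = refl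
sumTo-cong (suc N) f≗g = cong₂ _+_ (sumTo-cong N (λ i i<N → f≗g i (m<n⇒m<1+n i<N))) (f≗g N ≤-refl)

sumTo-+ : ∀ f a b → sumTo f (a + b) ≡ sumTo f a + sumTo (λ i → f (a + i)) b
sumTo-+ f a zero    rewrite +-identityʳ a = sym (+-identityʳ _)
sumTo-+ f a (suc b) rewrite +-suc a b | sumTo-+ f a b = +-assoc (sumTo f a) _ _

sumTo-* : ∀ c (f : ℕ → ℕ) N → sumTo (λ i → c * f i) N ≡ c * sumTo f N
sumTo-* c f zero    = sym (*-zeroʳ c)
sumTo-* c f (suc N) rewrite sumTo-* c f N = sym (*-distribˡ-+ c (sumTo f N) (f N))

f≤sumTo : ∀ f {N i} → i < N → f i ≤ sumTo f N
f≤sumTo f {suc N} i<1+N with m≤n⇒m<n∨m≡n (s≤s⁻¹ i<1+N)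
... | inj₁ i<N = ≤-trans (f≤sumTo f i<N) (m≤m+n _ _)
... | inj₂ refl = m≤n+m _ _

sumTo-digits< : ∀ k (g : ℕ → ℕ) N → (∀ i → i < N → g i < k) → sumTo (λ i → g i * k ^ i) N < k ^ N
sumTo-digits< k g zero    _   = s≤s z≤n
sumTo-digits< k g (suc N) g<k = begin-strict
  sumTo (λ i → g i * k ^ i) N + g N * k ^ N
    <⟨ +-monoˡ-< (g N * k ^ N) (sumTo-digits< k g N (λ i i<N → g<k i (m<n⇒m<1+n i<N))) ⟩
  k ^ N + g N * k ^ N
    ≤⟨ *-monoˡ-≤ (k ^ N) (g<k N ≤-refl) ⟩
  k * k ^ N ∎
  where open ≤-Reasoning

sumTo-update : ∀ {f g} N j → j < N → (∀ i → i < N → i ≢ j → f i ≡ g i) →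
               sumTo f N + g j ≡ sumTo g N + f j
sumTo-update {f} {g} (suc N) j j<1+N f≗g with m≤n⇒m<n∨m≡n (s≤s⁻¹ j<1+N)
... | inj₁ j<N = begin
  sumTo f N + f N + g j ≡⟨ +-rightComm (sumTo f N) (f N) (g j) ⟩
  sumTo f N + g j + f N ≡⟨ cong₂ _+_ (sumTo-update N j j<N (λ i i<N → f≗g i (m<n⇒m<1+n i<N)))
                                      (f≗g N ≤-refl (>⇒≢ j<N)) ⟩
  sumTo g N + f j + g N ≡⟨ +-rightComm (sumTo g N) (f j) (g N) ⟩
  sumTo g N + g N + f j ∎
  where open ≡-Reasoning
... | inj₂ refl = begin
  sumTo f j + f j + g j ≡⟨ +-rightComm (sumTo f j) (f j) (g j) ⟩
  sumTo f j + g j + f j ≡⟨ cong (λ x → x + g j + f j)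
                                 (sumTo-cong j (λ i i<j → f≗g i (m<n⇒m<1+n i<j) (<⇒≢ i<j))) ⟩
  sumTo g j + g j + f j ∎
  where open ≡-Reasoning

f≤maxTo : ∀ f {N i} → i < N → f i ≤ maxTo f N
f≤maxTo f {suc N} i<1+N with m≤n⇒m<n∨m≡n (s≤s⁻¹ i<1+N)
... | inj₁ i<N = ≤-trans (f≤maxTo f i<N) (m≤m⊔n _ _)
... | inj₂ refl = m≤n⊔m _ _

maxTo-lub : ∀ f N {b} → (∀ i → i < N → f i ≤ b) → maxTo f N ≤ b
maxTo-lub f zero    _   = z≤n
maxTo-lub f (suc N) f≤b = ⊔-lub (maxTo-lub f N (λ i i<N → f≤b i (m<n⇒m<1+n i<N))) (f≤b N ≤-refl)

maxTo-attained : ∀ f N → 0 < N → ∃[ i ] i < N × f i ≡ maxTo f N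
maxTo-attained f (suc zero)    _ = 0 , s≤s z≤n , refl
maxTo-attained f (suc (suc N)) _
  with ⊔-sel (maxTo f (suc N)) (f (suc N)) | maxTo-attained f (suc N) (s≤s z≤n)
... | inj₂ maxIsLast    | _                 = suc N , ≤-refl , sym maxIsLast
... | inj₁ maxIsEarlier | i , i<N , fi≡max = i , m<n⇒m<1+n i<N , trans fi≡max (sym maxIsEarlier)

record FirstHit (p : ℕ → Bool) (i N r : ℕ) : Set where
  field
    lower  : i ≤ r
    upper  : r ≤ i + N
    before : ∀ x → i ≤ x → x < r → p x ≡ false
    hit    : r < i + N → p r ≡ true

search-firstHit : ∀ p i N → FirstHit p i N (search p i N)
search-firstHit p i zero = record
  { lower  = ≤-refl
  ; upper  = m≤m+n i 0
  ; before = λ x i≤x x<i → contradiction (≤-<-trans i≤x x<i) (<-irrefl refl)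
  ; hit    = λ i<i+0 → contradiction (<-≤-trans i<i+0 (≤-reflexive (+-identityʳ i))) (<-irrefl refl)
  }
search-firstHit p i (suc N) with p i in pi
... | true = record
  { lower  = ≤-refl
  ; upper  = m≤m+n i _
  ; before = λ x i≤x x<i → contradiction (≤-<-trans i≤x x<i) (<-irrefl refl)
  ; hit    = λ _ → pi
  }
... | false = record
  { lower  = ≤-trans (n≤1+n i) lower
  ; upper  = ≤-trans upper (≤-reflexive (sym (+-suc i N)))
  ; before = before′
  ; hit    = λ r<i+1+N → hit (<-≤-trans r<i+1+N (≤-reflexive (+-suc i N)))
  }
  where
  open FirstHit (search-firstHit p (suc i) N)
  before′ : ∀ x → i ≤ x → x < search p (suc i) N → p x ≡ false
  before′ x i≤x x<r with m≤n⇒m<n∨m≡n i≤x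
  ... | inj₁ i<x = before x i<x x<r
  ... | inj₂ refl = pi

search-exact : ∀ p i N x → i ≤ x → x < i + N → (∀ y → i ≤ y → y < x → p y ≡ false) → p x ≡ true →
               search p i N ≡ x
search-exact p i N x i≤x x<i+N missBefore hitAt-x with <-cmp (search p i N) x
... | tri≈ _ r≡x _ = r≡x
... | tri< r<x _ _ = contradiction (trans (sym (hit (<-trans r<x x<i+N))) (missBefore _ lower r<x)) λ ()
  where open FirstHit (search-firstHit p i N)
... | tri> _ _ r>x = contradiction (trans (sym hitAt-x) (before x i≤x r>x)) λ ()
  where open FirstHit (search-firstHit p i N)


module ShiftGame (n′ k : ℕ) .{{_ : NonZero k}} (2≤k : 2 ≤ k) where

  n : ℕ
  n = suc n′

  open Game n k

  dig-cong : ∀ s {p q} → p % n ≡ q % n → dig s p ≡ dig s q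
  dig-cong s {p} {q} p≡q = cong (λ i → toℕ (lookup s i)) (fromℕ<-cong _ _ p≡q (m%n<n p n) (m%n<n q n))

  dig-+n : ∀ s p → dig s (p + n) ≡ dig s p
  dig-+n s p = dig-cong s {p + n} {p} ([m+n]%n≡m%n p n)

  dig<k : ∀ s p → dig s p < k
  dig<k s p = toℕ<n (at s p)

  dig-lookup : ∀ s {p} (p<n : p < n) → dig s p ≡ toℕ (lookup s (fromℕ< p<n))
  dig-lookup s {p} p<n = cong (λ i → toℕ (lookup s i)) (fromℕ<-cong _ _ (m<n⇒m%n≡m p<n) (m%n<n p n) p<n)

  toℕ-zeroL : toℕ zeroL ≡ 0
  toℕ-zeroL = toℕ-fromℕ< _

  digits≡0⇒zeroW : ∀ s → (∀ p → p < n → dig s p ≡ 0) → s ≡ zeroW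
  digits≡0⇒zeroW s dig≡0 = begin
    s                         ≡⟨ tabulate∘lookup s ⟨
    tabulate (lookup s)       ≡⟨ tabulate-cong (λ i → toℕ-injective (letter≡0 i)) ⟩
    tabulate (lookup zeroW)   ≡⟨ tabulate∘lookup zeroW ⟩
    zeroW                     ∎
    where
    open ≡-Reasoning
    letter≡0 : ∀ i → toℕ (lookup s i) ≡ toℕ (lookup zeroW i)
    letter≡0 i = begin
      toℕ (lookup s i)                          ≡⟨ cong (λ j → toℕ (lookup s j)) (fromℕ<-toℕ i (toℕ<n i)) ⟨
      toℕ (lookup s (fromℕ< (toℕ<n i)))         ≡⟨ dig-lookup s (toℕ<n i) ⟨
      dig s (toℕ i)                             ≡⟨ trans (dig≡0 (toℕ i) (toℕ<n i)) (sym toℕ-zeroL) ⟩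
      toℕ zeroL                                 ≡⟨ cong toℕ (lookup-replicate i zeroL) ⟨
      toℕ (lookup zeroW i)                      ∎

  dig-shift-n : ∀ c s → dig (shift c s) n ≡ toℕ c
  dig-shift-n c s = dig-+n (shift c s) 0

  dig-shift-suc : ∀ c s {i} → suc i < n → dig (shift c s) (suc i) ≡ dig s i
  dig-shift-suc c s {i} (s≤s i<n′) = trans (dig-lookup (shift c s) (s≤s i<n′))
    (cong toℕ (trans (lookup∘tabulate _ (fromℕ< i<n′)) (cong (at s) (toℕ-fromℕ< i<n′))))

  dig-shift-pred : ∀ c s {p} → 0 < p → p < n + n → p ≢ n → dig (shift c s) p ≡ dig s (p ∸ 1)
  dig-shift-pred c s {suc i} _ p<2n p≢n with <-cmp (suc i) n
  ... | tri< p<n _ _ = dig-shift-suc c s p<n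
  ... | tri≈ _ p≡n _ = contradiction p≡n p≢n
  ... | tri> _ _ p>n = begin
    dig (shift c s) (suc i)       ≡⟨ cong (dig (shift c s)) q+n≡i ⟨
    dig (shift c s) (suc q + n)   ≡⟨ dig-+n (shift c s) (suc q) ⟩
    dig (shift c s) (suc q)       ≡⟨ dig-shift-suc c s (+-cancelʳ-< n (suc q) n (subst (_< n + n) (sym q+n≡i) p<2n)) ⟩
    dig s q                       ≡⟨ dig-+n s q ⟨
    dig s (q + n)                 ≡⟨ cong (dig s) (suc-injective q+n≡i) ⟩
    dig s i                       ∎
    where
    open ≡-Reasoning
    q = i ∸ n
    q+n≡i : suc q + n ≡ suc i
    q+n≡i = cong suc (m∸n+n≡m (s≤s⁻¹ p>n))

  j+n∸[1+j]≡n′ : ∀ j → j + n ∸ suc j ≡ n′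
  j+n∸[1+j]≡n′ j = trans (cong (_∸ suc j) (+-suc j n′)) (m+n∸m≡n j n′)

  dig-shift-rotated : ∀ c s {i j} → i < n → j < n → i ≢ j → dig (shift c s) (j + n ∸ i) ≡ dig s (j + n ∸ suc i)
  dig-shift-rotated c s {i} {j} i<n j<n i≢j =
    trans (dig-shift-pred c s 0<x x<2n x≢n) (cong (dig s) (trans (∸-+-assoc (j + n) i 1) (cong (j + n ∸_) (+-comm i 1))))
    where
    x = j + n ∸ i
    i<j+n : i < j + n
    i<j+n = <-≤-trans i<n (m≤n+m n j)
    0<x : 0 < x
    0<x = m<n⇒0<n∸m i<j+n
    x<2n : x < n + n
    x<2n = ≤-<-trans (m∸n≤m (j + n) i) (+-monoˡ-< n j<n)
    x≢n : x ≢ n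
    x≢n x≡n = i≢j (+-cancelˡ-≡ n i j (begin
      n + i   ≡⟨ cong (_+ i) x≡n ⟨
      x + i   ≡⟨ m∸n+n≡m (<⇒≤ i<j+n) ⟩
      j + n   ≡⟨ +-comm j n ⟩
      n + j   ∎))
      where open ≡-Reasoning

  valAt-+n : ∀ s j → valAt s (j + n) ≡ valAt s j
  valAt-+n s j = sumTo-cong n λ i i<n → cong (_* k ^ i)
    (trans (cong (dig s) (+-∸-comm n (≤-trans i<n (m≤n+m n j)))) (dig-+n s (j + n ∸ suc i)))

  valAt≤val : ∀ s {j} → j < n → valAt s j ≤ val s
  valAt≤val s = f≤maxTo (valAt s)

  val-lub : ∀ s {b} → (∀ j → j < n → valAt s j ≤ b) → val s ≤ b
  val-lub s = maxTo-lub (valAt s) n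

  val-attained : ∀ s → ∃[ h ] h < n × valAt s h ≡ val s
  val-attained s = maxTo-attained (valAt s) n (s≤s z≤n)

  valAt-suc≤ : ∀ s {b} → (∀ j → j < n → valAt s j ≤ b) → ∀ {p} → p < n → valAt s (suc p) ≤ b
  valAt-suc≤ s {b} valAt≤b {p} p<n with <-cmp (suc p) n
  ... | tri< 1+p<n _ _ = valAt≤b (suc p) 1+p<n
  ... | tri≈ _ refl _  = subst (_≤ b) (sym (valAt-+n s 0)) (valAt≤b 0 (s≤s z≤n))
  ... | tri> _ _ 1+p>n = contradiction (s≤s⁻¹ 1+p>n) (<⇒≱ p<n)

  valAt-shift : ∀ c s {j} → j < n → valAt (shift c s) (suc j) + dig s n′ * k ^ j ≡ valAt s j + toℕ c * k ^ j
  valAt-shift c s {j} j<n = begin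
    sumTo f n + dig s n′ * k ^ j   ≡⟨ cong (λ p → sumTo f n + dig s p * k ^ j) (j+n∸[1+j]≡n′ j) ⟨
    sumTo f n + g j               ≡⟨ sumTo-update n j j<n f≗g ⟩
    sumTo g n + f j               ≡⟨ cong (λ d → sumTo g n + d * k ^ j) newLetter ⟩
    sumTo g n + toℕ c * k ^ j     ∎
    where
    open ≡-Reasoning
    newLetter : dig (shift c s) (j + n ∸ j) ≡ toℕ c
    newLetter = trans (cong (dig (shift c s)) (m+n∸m≡n j n)) (dig-shift-n c s)
    f g : ℕ → ℕ
    f i = dig (shift c s) (j + n ∸ i) * k ^ i
    g i = dig s (j + n ∸ suc i) * k ^ i
    f≗g : ∀ i → i < n → i ≢ j → f i ≡ g i
    f≗g i i<n i≢j = cong (_* k ^ i) (dig-shift-rotated c s i<n j<n i≢j)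

  valAt-suc : ∀ s j → dig s j ≡ 0 → valAt s (suc j) ≡ k * valAt s j
  valAt-suc s j dig≡0 = begin
    sumTo G n                                   ≡⟨ sumTo-+ G 1 n′ ⟩
    G 0 + sumTo (λ i → G (suc i)) n′            ≡⟨ cong₂ _+_ G0≡0 (sumTo-cong n′ (λ i _ → G-suc i)) ⟩
    sumTo (λ i → k * F i) n′                    ≡⟨ sumTo-* k F n′ ⟩
    k * sumTo F n′                              ≡⟨ cong (k *_) (+-identityʳ _) ⟨
    k * (sumTo F n′ + 0)                        ≡⟨ cong (λ x → k * (sumTo F n′ + x)) F-last≡0 ⟨
    k * (sumTo F n′ + F n′)                     ∎
    where
    open ≡-Reasoning
    F G : ℕ → ℕ
    F i = dig s (j + n ∸ suc i) * k ^ i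
    G i = dig s (j + n ∸ i) * k ^ i
    G0≡0 : G 0 ≡ 0
    G0≡0 = trans (*-identityʳ _) (trans (dig-+n s j) dig≡0)
    G-suc : ∀ i → G (suc i) ≡ k * F i
    G-suc i = *-leftComm (dig s (j + n ∸ suc i)) k (k ^ i)
    F-last≡0 : F n′ ≡ 0
    F-last≡0 = cong (_* k ^ n′) (trans (cong (dig s) (m+n∸n≡m j n)) dig≡0)

  valAt-zeroRun : ∀ s j a → (∀ p → j ≤ p → p < j + a → dig s p ≡ 0) → valAt s (j + a) ≡ k ^ a * valAt s j
  valAt-zeroRun s j zero    _      = trans (cong (valAt s) (+-identityʳ j)) (sym (*-identityˡ _))
  valAt-zeroRun s j (suc a) zeros = begin
    valAt s (j + suc a)         ≡⟨ cong (valAt s) (+-suc j a) ⟩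
    valAt s (suc (j + a))       ≡⟨ valAt-suc s (j + a) (zeros (j + a) (m≤m+n j a) (≤-reflexive (sym (+-suc j a)))) ⟩
    k * valAt s (j + a)         ≡⟨ cong (k *_) (valAt-zeroRun s j a shorterRun) ⟩
    k * (k ^ a * valAt s j)     ≡⟨ *-assoc k (k ^ a) _ ⟨
    k ^ suc a * valAt s j       ∎
    where
    open ≡-Reasoning
    shorterRun : ∀ p → j ≤ p → p < j + a → dig s p ≡ 0
    shorterRun p j≤p p<j+a = zeros p j≤p (<-trans p<j+a (+-monoʳ-< j ≤-refl))

  dig≤valAt-suc : ∀ s j → dig s j ≤ valAt s (suc j)
  dig≤valAt-suc s j = subst (_≤ valAt s (suc j)) (trans (*-identityʳ _) (dig-+n s j))
    (f≤sumTo (λ i → dig s (j + n ∸ i) * k ^ i) {n} (s≤s z≤n))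

  valAt≤0⇒zeroW : ∀ s → (∀ j → j < n → valAt s j ≤ 0) → s ≡ zeroW
  valAt≤0⇒zeroW s valAt≤0 = digits≡0⇒zeroW s λ p p<n →
    n≤0⇒n≡0 (≤-trans (dig≤valAt-suc s p) (valAt-suc≤ s valAt≤0 p<n))

  head<n : ∀ s → head s < n
  head<n s with val-attained s | <-cmp (head s) n
  ... | _ , _ , _         | tri< h<n _ _ = h<n
  ... | _ , _ , _         | tri> _ _ h>n = contradiction upper (<⇒≱ h>n)
    where open FirstHit (search-firstHit (λ m → valAt s m ≡ᵇ val s) 0 n)
  ... | h , h<n , valAt≡ | tri≈ _ h≡n _ =
    contradiction (trans (sym (before h z≤n (subst (h <_) (sym h≡n) h<n))) (dec-true (_ ≟ _) valAt≡)) λ ()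
    where open FirstHit (search-firstHit (λ m → valAt s m ≡ᵇ val s) 0 n)

  valAt-head : ∀ s → valAt s (head s) ≡ val s
  valAt-head s = ≡ᵇ⇒≡-true (hit (head<n s))
    where open FirstHit (search-firstHit (λ m → valAt s m ≡ᵇ val s) 0 n)

  lowPart highPart : Word → ℕ → ℕ → ℕ
  lowPart  s j i = sumTo (λ x → dig s (j + n ∸ suc x) * k ^ x) i
  highPart s j i = sumTo (λ y → dig s (j + n ∸ suc (i + y)) * k ^ y) (n ∸ i)

  valAt-split : ∀ s j {i} → i ≤ n → valAt s j ≡ lowPart s j i + k ^ i * highPart s j i
  valAt-split s j {i} i≤n = begin
    sumTo F n                                 ≡⟨ cong (sumTo F) (m+[n∸m]≡n i≤n) ⟨
    sumTo F (i + (n ∸ i))                     ≡⟨ sumTo-+ F i (n ∸ i) ⟩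
    lowPart s j i + sumTo (λ y → F (i + y)) (n ∸ i)
      ≡⟨ cong (lowPart s j i +_) (sumTo-cong (n ∸ i) λ y _ → shiftPower y) ⟩
    lowPart s j i + sumTo (λ y → k ^ i * H y) (n ∸ i)
      ≡⟨ cong (lowPart s j i +_) (sumTo-* (k ^ i) H (n ∸ i)) ⟩
    lowPart s j i + k ^ i * highPart s j i   ∎
    where
    open ≡-Reasoning
    F H : ℕ → ℕ
    F x = dig s (j + n ∸ suc x) * k ^ x
    H y = dig s (j + n ∸ suc (i + y)) * k ^ y
    shiftPower : ∀ y → F (i + y) ≡ k ^ i * H y
    shiftPower y = trans (cong (dig s (j + n ∸ suc (i + y)) *_) (^-distribˡ-+-* k i y))
                         (*-leftComm (dig s (j + n ∸ suc (i + y))) (k ^ i) (k ^ y))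

  lowPart< : ∀ s j i → lowPart s j i < k ^ i
  lowPart< s j i = sumTo-digits< k (λ x → dig s (j + n ∸ suc x)) i (λ x _ → dig<k s (j + n ∸ suc x))

  valAt-shiftZero : ∀ s {i} → i < n → valAt (shift zeroL s) (suc i) + dig s n′ * k ^ i ≡ valAt s i
  valAt-shiftZero s {i} i<n = trans (valAt-shift zeroL s i<n)
    (trans (cong (λ d → valAt s i + d * k ^ i) toℕ-zeroL) (+-identityʳ _))

  valAt-shiftZero-∸ : ∀ s {i} → i < n → valAt (shift zeroL s) (suc i) ≡ valAt s i ∸ dig s n′ * k ^ i
  valAt-shiftZero-∸ s {i} i<n =
    trans (sym (m+n∸n≡m _ (dig s n′ * k ^ i))) (cong (_∸ dig s n′ * k ^ i) (valAt-shiftZero s i<n))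

  record HeadAfterZeros (s : Word) (m : ℕ) : Set where
    field
      m<n     : m < n
      zeros   : ∀ p → p < m → dig s p ≡ 0
      maximal : ∀ j → j < n → valAt s j ≤ valAt s m

  module _ {s m} (H : HeadAfterZeros s m) where
    open HeadAfterZeros H

    private
      c = dig s n′
      s′ = shift zeroL s

    val≡valAt-head : val s ≡ valAt s m
    val≡valAt-head = ≤-antisym (val-lub s maximal) (valAt≤val s m<n)

    valAt-head-scaled : ∀ {j} → j ≤ m → valAt s m ≡ k ^ (m ∸ j) * valAt s j
    valAt-head-scaled {j} j≤m = trans (cong (valAt s) (sym j+a≡m))
      (valAt-zeroRun s j (m ∸ j) λ p _ p<j+a → zeros p (subst (p <_) j+a≡m p<j+a))
      where
      j+a≡m : j + (m ∸ j) ≡ m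
      j+a≡m = m+[n∸m]≡n j≤m

    valAt<valAt-head : s ≢ zeroW → ∀ {j} → j < m → valAt s j < valAt s m
    valAt<valAt-head s≢0 {j} j<m = subst (valAt s j <_) (sym scaled)
      (x<c*x (^-monoʳ-< k 2≤k (m<n⇒0<n∸m j<m)) (subst (0 <_) scaled 0<valAt))
      where
      scaled = valAt-head-scaled (<⇒≤ j<m)
      0<valAt : 0 < valAt s m
      0<valAt = n≢0⇒n>0 λ valAt≡0 → s≢0 (valAt≤0⇒zeroW s λ j j<n →
        subst (valAt s j ≤_) valAt≡0 (maximal j j<n))

    head≡ : s ≢ zeroW → head s ≡ m
    head≡ s≢0 = search-exact _ 0 n m z≤n m<n
      (λ j _ j<m → dec-false (_ ≟ _) λ valAt≡ →
        <-irrefl (trans valAt≡ val≡valAt-head) (valAt<valAt-head s≢0 j<m))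
      (dec-true (_ ≟ _) (sym val≡valAt-head))

    shiftZero-maximal-below : ∀ {i} → i < m → valAt s′ (suc i) ≤ valAt s′ (suc m)
    shiftZero-maximal-below {i} i<m = subst (valAt s′ (suc i) ≤_) (sym v′m≡)
      (m≤n*m (valAt s′ (suc i)) (k ^ a) {{m^n≢0 k a}})
      where
      a = m ∸ i
      i<n = <-trans i<m m<n
      k^a*k^i≡k^m : k ^ a * k ^ i ≡ k ^ m
      k^a*k^i≡k^m = trans (sym (^-distribˡ-+-* k a i)) (cong (k ^_) (m∸n+n≡m (<⇒≤ i<m)))
      lastLetter : k ^ a * (c * k ^ i) ≡ c * k ^ m
      lastLetter = trans (*-leftComm (k ^ a) c (k ^ i)) (cong (c *_) k^a*k^i≡k^m)
      v′m≡ : valAt s′ (suc m) ≡ k ^ a * valAt s′ (suc i)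
      v′m≡ = +-cancelʳ-≡ (c * k ^ m) _ _ (begin
        valAt s′ (suc m) + c * k ^ m                   ≡⟨ valAt-shiftZero s m<n ⟩
        valAt s m                                      ≡⟨ valAt-head-scaled (<⇒≤ i<m) ⟩
        k ^ a * valAt s i                              ≡⟨ cong (k ^ a *_) (valAt-shiftZero s i<n) ⟨
        k ^ a * (valAt s′ (suc i) + c * k ^ i)         ≡⟨ *-distribˡ-+ (k ^ a) _ _ ⟩
        k ^ a * valAt s′ (suc i) + k ^ a * (c * k ^ i) ≡⟨ cong (k ^ a * valAt s′ (suc i) +_) lastLetter ⟩
        k ^ a * valAt s′ (suc i) + c * k ^ m           ∎)
        where open ≡-Reasoning

    shiftZero-maximal-above : ∀ {i} → m < i → i < n → valAt s′ (suc i) ≤ valAt s′ (suc m)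
    shiftZero-maximal-above {i} m<i i<n with c in c≡
    ... | zero = subst₂ _≤_ (sym (v′≡ i<n)) (sym (v′≡ m<n)) (maximal i i<n)
      where
      v′≡ : ∀ {j} → j < n → valAt s′ (suc j) ≡ valAt s j
      v′≡ {j} j<n = trans (sym (+-identityʳ _))
        (trans (cong (λ d → valAt s′ (suc j) + d * k ^ j) (sym c≡)) (valAt-shiftZero s j<n))
    -- Cut both rotations after their lowest i digits: the high parts compare as the rotations do,
    -- the dropped letter costs rotation i at least k^i, and in rotation m it sits in the low part.
    ... | suc c-1 = subst₂ _≤_ (sym (valAt-shiftZero-∸ s i<n)) (sym (valAt-shiftZero-∸ s m<n)) (begin
      valAt s i ∸ c * K        ≤⟨ ∸-monoʳ-≤ (valAt s i) (m≤n*m K c {{subst NonZero (sym c≡) _}}) ⟩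
      valAt s i ∸ K            ≤⟨ m≤n+o⇒m∸n≤o (valAt s i) K vi≤ ⟩
      K * T                    ≤⟨ m≤m+n (K * T) (R ∸ c * k ^ m) ⟩
      K * T + (R ∸ c * k ^ m)  ≡⟨ +-∸-assoc (K * T) c*k^m≤R ⟨
      K * T + R ∸ c * k ^ m    ≡⟨ cong (_∸ c * k ^ m) (trans (+-comm (K * T) R) (sym (valAt-split s m (<⇒≤ i<n)))) ⟩
      valAt s m ∸ c * k ^ m    ∎)
      where
      open ≤-Reasoning
      K = k ^ i
      Q = lowPart s i i
      P = highPart s i i
      R = lowPart s m i
      T = highPart s m i
      c*k^m≤R : c * k ^ m ≤ R
      c*k^m≤R = subst (_≤ R) (cong (λ p → dig s p * k ^ m) (j+n∸[1+j]≡n′ m))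
        (f≤sumTo (λ x → dig s (m + n ∸ suc x) * k ^ x) m<i)
      P≤T : P ≤ T
      P≤T = s≤s⁻¹ (*-cancelˡ-< K P (suc T) (begin-strict
        K * P       ≤⟨ m≤n+m (K * P) Q ⟩
        Q + K * P   ≡⟨ valAt-split s i (<⇒≤ i<n) ⟨
        valAt s i   ≤⟨ maximal i i<n ⟩
        valAt s m   ≡⟨ valAt-split s m (<⇒≤ i<n) ⟩
        R + K * T   <⟨ +-monoˡ-< (K * T) (lowPart< s m i) ⟩
        K + K * T   ≡⟨ *-suc K T ⟨
        K * suc T   ∎))
      vi≤ : valAt s i ≤ K + K * T
      vi≤ = begin
        valAt s i   ≡⟨ valAt-split s i (<⇒≤ i<n) ⟩
        Q + K * P   ≤⟨ +-mono-≤ (<⇒≤ (lowPart< s i i)) (*-monoʳ-≤ K P≤T) ⟩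
        K + K * T   ∎

    shiftZero-maximal : ∀ {i} → i < n → valAt s′ (suc i) ≤ valAt s′ (suc m)
    shiftZero-maximal {i} i<n with <-cmp i m
    ... | tri< i<m _ _  = shiftZero-maximal-below i<m
    ... | tri≈ _ refl _ = ≤-refl
    ... | tri> _ _ i>m  = shiftZero-maximal-above i>m i<n

    HeadAfterZeros-shiftZero : suc m < n → HeadAfterZeros s′ (suc m)
    HeadAfterZeros-shiftZero 1+m<n = record
      { m<n     = 1+m<n
      ; zeros   = λ { zero _ → toℕ-zeroL
                    ; (suc p) (s≤s p<m) → trans (dig-shift-suc zeroL s (<-trans (s≤s p<m) 1+m<n)) (zeros p p<m) }
      ; maximal = λ { zero _ → subst (_≤ valAt s′ (suc m)) (valAt-+n s′ 0) (shiftZero-maximal ≤-refl)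
                    ; (suc i) (s≤s i<n′) → shiftZero-maximal (m<n⇒m<1+n i<n′) }
      }

    shiftZero≡zeroW : ¬ (suc m < n) → s′ ≡ zeroW
    shiftZero≡zeroW 1+m≮n = digits≡0⇒zeroW s′ λ
      { zero _ → toℕ-zeroL
      ; (suc p) 1+p<n → trans (dig-shift-suc zeroL s 1+p<n)
                               (zeros p (<-≤-trans (s≤s⁻¹ 1+p<n) (s≤s⁻¹ (≮⇒≥ 1+m≮n)))) }

    valAt+power-shiftZero : valAt s m + k ^ m ≤ valAt s′ (suc m) + k ^ suc m
    valAt+power-shiftZero = begin
      valAt s m + k ^ m                 ≡⟨ cong (_+ k ^ m) (valAt-shiftZero s m<n) ⟨
      v′ + c * k ^ m + k ^ m            ≡⟨ +-assoc v′ (c * k ^ m) (k ^ m) ⟩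
      v′ + (c * k ^ m + k ^ m)          ≡⟨ cong (v′ +_) (+-comm (c * k ^ m) (k ^ m)) ⟩
      v′ + suc c * k ^ m                ≤⟨ +-monoʳ-≤ v′ (*-monoˡ-≤ (k ^ m) (dig<k s n′)) ⟩
      v′ + k ^ suc m                    ∎
      where
      open ≤-Reasoning
      v′ = valAt s′ (suc m)

  window≡0⇒zeroW : ∀ s {h} → h ≤ n → (∀ q → h ≤ q → q < h + n → dig s q ≡ 0) → s ≡ zeroW
  window≡0⇒zeroW s {h} h≤n window≡0 = digits≡0⇒zeroW s λ p p<n → case p <? h of λ
    { (yes p<h) → trans (sym (dig-+n s p)) (window≡0 (p + n) (≤-trans h≤n (m≤n+m n p)) (+-monoˡ-< n p<h))
    ; (no  p≮h) → window≡0 p (≮⇒≥ p≮h) (<-≤-trans p<n (m≤n+m n h)) }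

  %≡n′⇒≡n′ : ∀ {h y} → h < n → y < h + n → y % n ≡ n′ → y ≡ n′
  %≡n′⇒≡n′ {h} {y} h<n y<h+n y%n≡n′ with y <? n
  ... | yes y<n = trans (sym (m<n⇒m%n≡m y<n)) y%n≡n′
  ... | no  y≮n = contradiction (≤-trans (s≤s⁻¹ h<n) (≤-reflexive (sym z≡n′))) (<⇒≱ z<h)
    where
    z = y ∸ n
    z+n≡y : z + n ≡ y
    z+n≡y = m∸n+n≡m (≮⇒≥ y≮n)
    z<h : z < h
    z<h = +-cancelʳ-< n z h (subst (_< h + n) (sym z+n≡y) y<h+n)
    z≡n′ : z ≡ n′
    z≡n′ = begin
      z               ≡⟨ m<n⇒m%n≡m (<-trans z<h h<n) ⟨
      z % n           ≡⟨ [m+n]%n≡m%n z n ⟨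
      (z + n) % n     ≡⟨ cong (_% n) z+n≡y ⟩
      y % n           ≡⟨ y%n≡n′ ⟩
      n′              ∎
      where open ≡-Reasoning

  tailGap : Word → ℕ
  tailGap s = search (λ d → not (dig s (head s + n ∸ d) ≡ᵇ 0)) 1 n

  tailGap<1+n : ∀ s → s ≢ zeroW → tailGap s < 1 + n
  tailGap<1+n s s≢0 with tailGap s <? 1 + n
  ... | yes gap<1+n = gap<1+n
  ... | no  gap≮1+n = contradiction (window≡0⇒zeroW s (<⇒≤ (head<n s)) window≡0) s≢0
    where
    open FirstHit (search-firstHit (λ d → not (dig s (head s + n ∸ d) ≡ᵇ 0)) 1 n)
    window≡0 : ∀ q → head s ≤ q → q < head s + n → dig s q ≡ 0
    window≡0 q h≤q q<h+n = subst (λ p → dig s p ≡ 0) (m∸[m∸n]≡n (<⇒≤ q<h+n))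
      (nonzero≡false⇒≡0 (before (head s + n ∸ q) (m<n⇒0<n∸m q<h+n)
                                (<-≤-trans (s≤s x≤n) (≮⇒≥ gap≮1+n))))
      where
      x≤n : head s + n ∸ q ≤ n
      x≤n = ≤-trans (∸-monoʳ-≤ (head s + n) h≤q) (≤-reflexive (m+n∸m≡n (head s) n))

  tailGap≡ : ∀ s → s ≢ zeroW → tail s ≡ n′ → tailGap s ≡ suc (head s)
  tailGap≡ s s≢0 tail≡n′ = +-cancelˡ-≡ n′ _ _ (begin
    n′ + d             ≡⟨ cong (_+ d) y≡n′ ⟨
    y + d              ≡⟨ m∸n+n≡m d≤h+n ⟩
    h + suc n′         ≡⟨ +-suc h n′ ⟩
    suc (h + n′)       ≡⟨ cong suc (+-comm h n′) ⟩
    suc (n′ + h)       ≡⟨ +-suc n′ h ⟨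
    n′ + suc h         ∎)
    where
    open ≡-Reasoning
    open FirstHit (search-firstHit (λ d → not (dig s (head s + n ∸ d) ≡ᵇ 0)) 1 n)
    h = head s
    d = tailGap s
    y = h + n ∸ d
    d≤h+n : d ≤ h + n
    d≤h+n = ≤-trans (s≤s⁻¹ (tailGap<1+n s s≢0)) (m≤n+m n h)
    y≡n′ : y ≡ n′
    y≡n′ = %≡n′⇒≡n′ (head<n s) (∸-monoʳ-< lower d≤h+n) tail≡n′

  Atail≡ : ∀ s → s ≢ zeroW → Atail s ≡ (tail s ≡ᵇ n′)
  Atail≡ s s≢0 = cong (λ z → not z ∧ (tail s ≡ᵇ n′)) (dec-false (≡-dec Fin._≟_ s zeroW) s≢0)

  Atail≡true⇒≢zeroW : ∀ {s} → Atail s ≡ true → s ≢ zeroW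
  Atail≡true⇒≢zeroW {s} A≡true s≡0 =
    contradiction (trans (sym A≡true) (cong (λ z → not z ∧ (tail s ≡ᵇ n′)) (dec-true (≡-dec Fin._≟_ s zeroW) s≡0)))
                  λ ()

  Atail⇒HeadAfterZeros : ∀ {s} → Atail s ≡ true → HeadAfterZeros s (head s)
  Atail⇒HeadAfterZeros {s} A≡true = record
    { m<n     = head<n s
    ; zeros   = zeros
    ; maximal = λ j j<n → subst (valAt s j ≤_) (sym (valAt-head s)) (valAt≤val s j<n)
    }
    where
    open FirstHit (search-firstHit (λ d → not (dig s (head s + n ∸ d) ≡ᵇ 0)) 1 n)
    h = head s
    s≢0 = Atail≡true⇒≢zeroW A≡true
    zeros : ∀ p → p < h → dig s p ≡ 0
    zeros p p<h = begin
      dig s p                    ≡⟨ dig-+n s p ⟨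
      dig s (p + n)              ≡⟨ cong (dig s) index ⟨
      dig s (h + n ∸ (h ∸ p))    ≡⟨ nonzero≡false⇒≡0 (before (h ∸ p) (m<n⇒0<n∸m p<h) h∸p<gap) ⟩
      0                          ∎
      where
      open ≡-Reasoning
      index : h + n ∸ (h ∸ p) ≡ p + n
      index = trans (+-∸-comm n (m∸n≤m h p)) (cong (_+ n) (m∸[m∸n]≡n (<⇒≤ p<h)))
      h∸p<gap : h ∸ p < tailGap s
      h∸p<gap = subst (h ∸ p <_) (sym (tailGap≡ s s≢0 (≡ᵇ⇒≡-true (trans (sym (Atail≡ s s≢0)) A≡true))))
                      (s≤s (m∸n≤m h p))

  HeadAfterZeros⇒Atail : ∀ {s m} → HeadAfterZeros s m → s ≢ zeroW → dig s n′ ≢ 0 → Atail s ≡ true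
  HeadAfterZeros⇒Atail {s} {m} H s≢0 last≢0 = trans (Atail≡ s s≢0) (dec-true (tail s ≟ n′) tail≡n′)
    where
    open HeadAfterZeros H
    zeroBehind : ∀ x → 1 ≤ x → x < suc m → dig s (m + n ∸ x) ≡ 0
    zeroBehind x 1≤x x<1+m = begin
      dig s (m + n ∸ x)   ≡⟨ cong (dig s) (+-∸-comm n (s≤s⁻¹ x<1+m)) ⟩
      dig s (m ∸ x + n)   ≡⟨ dig-+n s (m ∸ x) ⟩
      dig s (m ∸ x)       ≡⟨ zeros (m ∸ x) (∸-monoʳ-< 1≤x (s≤s⁻¹ x<1+m)) ⟩
      0                   ∎
      where open ≡-Reasoning
    gap≡ : search (λ d → not (dig s (m + n ∸ d) ≡ᵇ 0)) 1 n ≡ suc m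
    gap≡ = search-exact _ 1 n (suc m) (s≤s z≤n) (s≤s m<n)
      (λ x 1≤x x<1+m → cong not (dec-true (_ ≟ 0) (zeroBehind x 1≤x x<1+m)))
      (≢0⇒nonzero≡true (subst (λ p → dig s p ≢ 0) (sym (j+n∸[1+j]≡n′ m)) last≢0))
    tail≡n′ : tail s ≡ n′
    tail≡n′ = begin
      (head s + n ∸ tailGap s) % n
        ≡⟨ cong (λ h → (h + n ∸ search (λ d → not (dig s (h + n ∸ d) ≡ᵇ 0)) 1 n) % n) (head≡ H s≢0) ⟩
      (m + n ∸ search (λ d → not (dig s (m + n ∸ d) ≡ᵇ 0)) 1 n) % n
        ≡⟨ cong (λ r → (m + n ∸ r) % n) gap≡ ⟩
      (m + n ∸ suc m) % n  ≡⟨ cong (_% n) (j+n∸[1+j]≡n′ m) ⟩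
      n′ % n               ≡⟨ m<n⇒m%n≡m ≤-refl ⟩
      n′                   ∎
      where open ≡-Reasoning

  toℕ-inc : ∀ σ → suc (toℕ σ) < k → toℕ (inc σ) ≡ suc (toℕ σ)
  toℕ-inc σ σ+1<k with suc (toℕ σ) <? k
  ... | yes σ+1<k′ = toℕ-fromℕ< σ+1<k′
  ... | no  σ+1≮k  = contradiction σ+1<k σ+1≮k

  valAt-rotate : ∀ s {h} → h < n → valAt (shift (at s n′) s) (suc h) ≡ valAt s h
  valAt-rotate s {h} h<n = +-cancelʳ-≡ (dig s n′ * k ^ h) _ _ (valAt-shift (at s n′) s h<n)

  val≤val-rotate : ∀ s → val s ≤ val (shift (at s n′) s)
  val≤val-rotate s = begin
    val s                                         ≡⟨ valAt-head s ⟨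
    valAt s (head s)                              ≡⟨ valAt-rotate s (head<n s) ⟨
    valAt (shift (at s n′) s) (suc (head s))      ≤⟨ valAt-suc≤ s′ (λ j → valAt≤val s′) (head<n s) ⟩
    val s′                                        ∎
    where
    open ≤-Reasoning
    s′ = shift (at s n′) s

  valAt+power≤val-bobMove : ∀ s → suc (dig s n′) < k → ∀ {h} → h < n →
                            valAt s h + k ^ h ≤ val (shift (inc (at s n′)) s)
  valAt+power≤val-bobMove s last+1<k {h} h<n = subst (_≤ val s′) valAt′≡ (valAt-suc≤ s′ (λ j → valAt≤val s′) h<n)
    where
    s′ = shift (inc (at s n′)) s
    c = dig s n′
    valAt′≡ : valAt s′ (suc h) ≡ valAt s h + k ^ h
    valAt′≡ = +-cancelʳ-≡ (c * k ^ h) _ _ (begin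
      valAt s′ (suc h) + c * k ^ h         ≡⟨ valAt-shift (inc (at s n′)) s h<n ⟩
      valAt s h + toℕ (inc (at s n′)) * k ^ h ≡⟨ cong (λ d → valAt s h + d * k ^ h) (toℕ-inc (at s n′) last+1<k) ⟩
      valAt s h + (k ^ h + c * k ^ h)      ≡⟨ +-assoc (valAt s h) (k ^ h) (c * k ^ h) ⟨
      valAt s h + k ^ h + c * k ^ h        ∎)
      where open ≡-Reasoning

  data Above (V : ℕ) (s : Word) : Set where
    reached : V ≤ val s → Above V s
    pending : ∀ {m} → HeadAfterZeros s m → V < valAt s m + k ^ m → Above V s

  ≤val⇒<valAt-head+power : ∀ {V s} → V ≤ val s → V < valAt s (head s) + k ^ head s
  ≤val⇒<valAt-head+power {s = s} V≤val =
    ≤-<-trans (≤-trans V≤val (≤-reflexive (sym (valAt-head s)))) (m<m+n _ (m^n>0 k (head s)))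

  above-bobMove : ∀ {V s} → Above V s → suc (dig s n′) < k → V < val (shift (inc (at s n′)) s)
  above-bobMove {s = s} (reached V≤val) last+1<k =
    <-≤-trans (≤val⇒<valAt-head+power {s = s} V≤val) (valAt+power≤val-bobMove s last+1<k (head<n s))
  above-bobMove {s = s} (pending H V<) last+1<k =
    <-≤-trans V< (valAt+power≤val-bobMove s last+1<k (HeadAfterZeros.m<n H))

  above-shiftZero : ∀ {V s m} → HeadAfterZeros s m → V < valAt s m + k ^ m → shift zeroL s ≢ zeroW →
                    Above V (shift zeroL s)
  above-shiftZero {m = m} H V< s′≢0 with suc m <? n
  ... | yes 1+m<n = pending (HeadAfterZeros-shiftZero H 1+m<n) (<-≤-trans V< (valAt+power-shiftZero H))
  ... | no  1+m≮n = contradiction (shiftZero≡zeroW H 1+m≮n) s′≢0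

  above-aliceMove : ∀ {V s} → Above V s → Atail s ≡ true → shift zeroL s ≢ zeroW → Above V (shift zeroL s)
  above-aliceMove {s = s} (reached V≤val) A≡true =
    above-shiftZero (Atail⇒HeadAfterZeros {s} A≡true) (≤val⇒<valAt-head+power {s = s} V≤val)
  above-aliceMove (pending H V<) _ = above-shiftZero H V<

  above-pass : ∀ {V s} → Above V s → s ≢ zeroW → Atail s ≡ false → shift (at s n′) s ≢ zeroW →
               Above V (shift (at s n′) s)
  above-pass {s = s} (reached V≤val) _ _ _ = reached (≤-trans V≤val (val≤val-rotate s))
  above-pass {V} {s} (pending H V<) s≢0 A≡false s′≢0 =
    subst (λ σ → Above V (shift σ s)) zeroL≡last
      (above-shiftZero H V< (subst (λ σ → shift σ s ≢ zeroW) (sym zeroL≡last) s′≢0))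
    where
    last≡0 : dig s n′ ≡ 0
    last≡0 with dig s n′ ≟ 0
    ... | yes last≡0 = last≡0
    ... | no  last≢0 = contradiction (trans (sym A≡false) (HeadAfterZeros⇒Atail H s≢0 last≢0)) λ ()
    zeroL≡last : zeroL ≡ at s n′
    zeroL≡last = toℕ-injective (trans toℕ-zeroL (sym last≡0))

  module Play (B : Word → Bool) (isBob : IsBobStrategy B) where

    s[_] : ℕ → Word
    s[ t ] = play Atail B t

    bob⇒last+1<k : ∀ s → B s ≡ true → suc (dig s n′) < k
    bob⇒last+1<k s B≡true = ≤∧≢⇒< (dig<k s n′) λ 1+last≡k →
      contradiction (trans (sym B≡true) (isBob s (cong (_∸ 1) 1+last≡k))) λ ()

    step-bob : ∀ s → B s ≡ true → step Atail B s ≡ shift (inc (at s n′)) s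
    step-bob s B≡true rewrite B≡true = refl

    step-alice : ∀ s → B s ≡ false → Atail s ≡ true → step Atail B s ≡ shift zeroL s
    step-alice s B≡false A≡true rewrite B≡false | A≡true = refl

    step-pass : ∀ s → B s ≡ false → Atail s ≡ false → step Atail B s ≡ shift (at s n′) s
    step-pass s B≡false A≡false rewrite B≡false | A≡false = refl

    above-step : ∀ {V s} → Above V s → s ≢ zeroW → step Atail B s ≢ zeroW → Above V (step Atail B s)
    above-step {V} {s} above s≢0 s′≢0 = byMoves (B s) (Atail s) refl refl
      where
      byMoves : ∀ b a → B s ≡ b → Atail s ≡ a → Above V (step Atail B s)
      byMoves true  _     B≡ _  = subst (Above V) (sym (step-bob s B≡))
        (reached (<⇒≤ (above-bobMove above (bob⇒last+1<k s B≡))))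
      byMoves false true  B≡ A≡ = subst (Above V) (sym (step-alice s B≡ A≡))
        (above-aliceMove above A≡ (subst (_≢ zeroW) (step-alice s B≡ A≡) s′≢0))
      byMoves false false B≡ A≡ = subst (Above V) (sym (step-pass s B≡ A≡))
        (above-pass above s≢0 A≡ (subst (_≢ zeroW) (step-pass s B≡ A≡) s′≢0))

    above-play : ∀ {t₁ t₂} → Continues Atail B t₂ → ∀ d → d + suc t₁ ≤ t₂ →
                 Above (val s[ suc t₁ ]) s[ d + suc t₁ ]
    above-play continues zero    _        = reached ≤-refl
    above-play {t₁} continues (suc d) d+1+t₁<t₂ =
      above-step {s = s[ d + suc t₁ ]} (above-play continues d (<⇒≤ d+1+t₁<t₂))
        (continues (d + suc t₁) (≤-trans (s≤s z≤n) (m≤n+m (suc t₁) d)) (<⇒≤ d+1+t₁<t₂))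
        (continues (suc d + suc t₁) (s≤s z≤n) d+1+t₁<t₂)

    above-at : ∀ {t₁ t₂} → t₁ < t₂ → Continues Atail B t₂ → Above (val s[ suc t₁ ]) s[ t₂ ]
    above-at {t₁} {t₂} t₁<t₂ continues =
      subst (λ t → Above (val s[ suc t₁ ]) s[ t ]) (m∸n+n≡m t₁<t₂)
      (above-play continues (t₂ ∸ suc t₁) (≤-reflexive (m∸n+n≡m t₁<t₂)))

claim30 : (n k : ℕ) .{{_ : NonZero n}} .{{_ : NonZero k}} → 2 ≤ k →
    (B : Game.Word n k → Bool) → Game.IsBobStrategy n k B →
    (t₁ t₂ : ℕ) → t₁ < t₂ → Game.Continues n k (Game.Atail n k) B t₂ →
    B (Game.play n k (Game.Atail n k) B t₁) ≡ true →
    B (Game.play n k (Game.Atail n k) B t₂) ≡ true →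
    Game.val n k (Game.play n k (Game.Atail n k) B (suc t₁))
      < Game.val n k (Game.play n k (Game.Atail n k) B (suc t₂))
claim30 (suc n′) k 2≤k B isBob t₁ t₂ t₁<t₂ continues _ bobMovesAt-t₂ =
  subst (λ s → val s[ suc t₁ ] < val s) (sym (step-bob s[ t₂ ] bobMovesAt-t₂))
    (above-bobMove (above-at t₁<t₂ continues) (bob⇒last+1<k s[ t₂ ] bobMovesAt-t₂))
  where
  open Game (suc n′) k using (val)
  open ShiftGame n′ k 2≤k
  open Play B isBob
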